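{- For every positive integer $n$ and every $\pi\in S_n$, $$L_n(\pi)=\left(\frac{n!-n}{n!}\right)^2 L_n.$$
   Context: An $n$-th order Latin Square is an $n\times n$ grid filled with the symbols $1,\dots,n$ such that each symbol appears exactly once in each row and each column. $L_n$ denotes the total number of $n$-th order Latin Squares. Rows read left to right and columns read top to bottom give permutations of $\{1,\dots,n\}$. A permutation contains a pattern $\pi$ if some subsequence is order isomorphic to $\pi$, and avoids it otherwise (for $\pi\in S_n$ and a permutation of length $n$, containing $\pi$ means being equal to $\pi$). A Latin Square avoids $\pi$ if all its row and column permutations avoid $\pi$, and $L_n(\pi)$ is the number of $n$-th order Latin Squares avoiding $\pi$. -}

module Defs where

open import Data.Nat using (ℕ; zero; suc)
open import Data.Fin using (Fin; _<_; _<?_)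
open import Data.Fin.Properties using (_≟_)
open import Data.List using (List; []; _∷_; [_]; map; concatMap; allFin; filter; length)
open import Data.List.Relation.Unary.All using (All; all?)
open import Data.List.Relation.Unary.Any using (Any; any?)
open import Data.Vec using (Vec; lookup; transpose; toList) renaming (_∷_ to _∷ᵥ_; [] to []ᵥ)
open import Data.Product using (_×_)
open import Relation.Binary.PropositionalEquality using (_≡_)
open import Relation.Nullary using (Dec; ¬_; ¬?)
open import Relation.Nullary.Decidable using (_×-dec_; _→-dec_)

allVec : ∀ {a} {A : Set a} (k : ℕ) → List A → List (Vec A k)
allVec zero    xs = [ []ᵥ ]
allVec (suc k) xs = concatMap (λ x → map (x ∷ᵥ_) (allVec k xs)) xs

-- A word v of length n over Fin n (i.e. values in {1..n}, 0-indexed) is a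
-- permutation iff it is injective.
IsPerm : ∀ {n} → Vec (Fin n) n → Set
IsPerm {n} v = All (λ i → All (λ j → lookup v i ≡ lookup v j → i ≡ j) (allFin n)) (allFin n)

isPerm? : ∀ {n} (v : Vec (Fin n) n) → Dec (IsPerm v)
isPerm? {n} v = all? (λ i → all? (λ j → (lookup v i ≟ lookup v j) →-dec (i ≟ j)) (allFin n)) (allFin n)

Increasing : ∀ {k m} → Vec (Fin m) k → Set
Increasing {k} f = All (λ i → All (λ j → i < j → lookup f i < lookup f j) (allFin k)) (allFin k)

increasing? : ∀ {k m} (f : Vec (Fin m) k) → Dec (Increasing f)
increasing? {k} f = all? (λ i → all? (λ j → (i <? j) →-dec (lookup f i <? lookup f j)) (allFin k)) (allFin k)

OrderIso : ∀ {k m} → Vec (Fin k) k → Vec (Fin m) m → Vec (Fin m) k → Set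
OrderIso {k} π v f =
  All (λ i → All (λ j →
    (lookup π i < lookup π j → lookup v (lookup f i) < lookup v (lookup f j)) ×
    (lookup v (lookup f i) < lookup v (lookup f j) → lookup π i < lookup π j)) (allFin k)) (allFin k)

orderIso? : ∀ {k m} (π : Vec (Fin k) k) (v : Vec (Fin m) m) (f : Vec (Fin m) k) → Dec (OrderIso π v f)
orderIso? {k} π v f = all? (λ i → all? (λ j →
    ((lookup π i <? lookup π j) →-dec (lookup v (lookup f i) <? lookup v (lookup f j))) ×-dec
    ((lookup v (lookup f i) <? lookup v (lookup f j)) →-dec (lookup π i <? lookup π j))) (allFin k)) (allFin k)

Contains : ∀ {k m} → Vec (Fin k) k → Vec (Fin m) m → Set
Contains {k} {m} π v = Any (λ f → Increasing f × OrderIso π v f) (allVec k (allFin m))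

contains? : ∀ {k m} (π : Vec (Fin k) k) (v : Vec (Fin m) m) → Dec (Contains π v)
contains? {k} {m} π v = any? (λ f → increasing? f ×-dec orderIso? π v f) (allVec k (allFin m))

-- An n × n grid, as the vector of its rows; columns are given by transpose.
Grid : ℕ → Set
Grid n = Vec (Vec (Fin n) n) n

allGrids : (n : ℕ) → List (Grid n)
allGrids n = allVec n (allVec n (allFin n))

IsLatin : ∀ {n} → Grid n → Set
IsLatin g = All IsPerm (toList g) × All IsPerm (toList (transpose g))

isLatin? : ∀ {n} (g : Grid n) → Dec (IsLatin g)
isLatin? g = all? isPerm? (toList g) ×-dec all? isPerm? (toList (transpose g))

Avoids : ∀ {k n} → Vec (Fin k) k → Grid n → Set
Avoids π g = All (λ r → ¬ Contains π r) (toList g) × All (λ c → ¬ Contains π c) (toList (transpose g))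

avoids? : ∀ {k n} (π : Vec (Fin k) k) (g : Grid n) → Dec (Avoids π g)
avoids? π g = all? (λ r → ¬? (contains? π r)) (toList g) ×-dec all? (λ c → ¬? (contains? π c)) (toList (transpose g))

L : ℕ → ℕ
L n = length (filter isLatin? (allGrids n))

L-avoid : (n : ℕ) → Vec (Fin n) n → ℕ
L-avoid n π = length (filter (λ g → isLatin? g ×-dec avoids? π g) (allGrids n))

module Submission where

-- Since π has the same length n as the rows and columns, a row or column contains
-- π only if it equals π (contains⇒≡).  The proof double counts the triples
-- (g, ρ, τ) where g is a Latin square, ρ and τ are permutations of Fin n, and the
-- square obtained from g by permuting its rows by ρ and its columns by τ avoids π.
--   * For fixed (ρ, τ) this relabelling is a bijection of grids preserving
--     Latinness, so there are L_n(π) triples, n!² · L_n(π) in total.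
--   * For a fixed Latin g, the relabelled square avoids π iff no row of g read
--     along τ and no column of g read along ρ spells π.  Each row spells π along
--     exactly one permutation, and no permutation is spelled along by two rows, so
--     n! − n choices of τ remain, and likewise of ρ: (n! − n)² · L_n in total.

open import Defs
open import Data.Nat using (ℕ; zero; suc; _+_; _*_; _∸_; _^_; _≤_; _!)
open import Data.Nat.Properties
open import Algebra.Properties.CommutativeSemigroup +-commutativeSemigroup using () renaming (interchange to +-interchange)
open import Data.Fin as F using (Fin; punchIn; punchOut)
import Data.Fin.Properties as FP
open import Data.Fin.Induction using (<-wellFounded; Acc; acc)
open import Data.List using (List; []; _∷_; map; concatMap; allFin; filter; length; _++_)
import Data.List.Properties as LP
open import Data.List.Membership.Propositional using (_∈_; lose)
open import Data.List.Membership.Propositional.Properties using (∈-allFin)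
open import Data.List.Relation.Unary.All as All using (All; []; _∷_)
open import Data.List.Relation.Unary.Any as Any using (here; there)
open import Data.Vec as V using (Vec; lookup; transpose; toList)
import Data.Vec.Properties as VP
open import Data.Bool using (true; false; if_then_else_)
open import Data.Empty using (⊥-elim)
open import Data.Product using (∃; _×_; _,_; proj₁; proj₂)
open import Function using (id; _∘_; flip)
open import Function.Definitions using (Injective)
open import Relation.Binary.PropositionalEquality
open import Relation.Binary.Definitions using (DecidableEquality; tri<; tri≈; tri>)
open import Relation.Nullary using (Dec; yes; no; ¬_; does; ¬?)
open import Relation.Nullary.Decidable using (_×-dec_; _→-dec_; map′)
open import Relation.Unary using (Decidable)

⟦_⟧ : ∀ {p} {X : Set p} → Dec X → ℕ
⟦ d ⟧ = if does d then 1 else 0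

⟦⟧-yes : ∀ {p} {X : Set p} (d : Dec X) → X → ⟦ d ⟧ ≡ 1
⟦⟧-yes (yes _) _ = refl
⟦⟧-yes (no ¬x) x = ⊥-elim (¬x x)

⟦⟧-no : ∀ {p} {X : Set p} (d : Dec X) → ¬ X → ⟦ d ⟧ ≡ 0
⟦⟧-no (yes x) ¬x = ⊥-elim (¬x x)
⟦⟧-no (no _) _ = refl

⟦⟧-pos : ∀ {p} {X : Set p} (d : Dec X) → 1 ≤ ⟦ d ⟧ → X
⟦⟧-pos (yes x) _ = x

⟦⟧-cong : ∀ {p q} {X : Set p} {Y : Set q} (d : Dec X) (e : Dec Y) → (X → Y) → (Y → X) → ⟦ d ⟧ ≡ ⟦ e ⟧
⟦⟧-cong (yes x) e f g = sym (⟦⟧-yes e (f x))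
⟦⟧-cong (no ¬x) e f g = sym (⟦⟧-no e (¬x ∘ g))

⟦⟧-× : ∀ {p q} {X : Set p} {Y : Set q} (d : Dec X) (e : Dec Y) → ⟦ d ×-dec e ⟧ ≡ ⟦ d ⟧ * ⟦ e ⟧
⟦⟧-× (yes x) e = sym (+-identityʳ ⟦ e ⟧)
⟦⟧-× (no ¬x) e = refl

∑ : ∀ {a} {A : Set a} → List A → (A → ℕ) → ℕ
∑ []       w = 0
∑ (x ∷ xs) w = w x + ∑ xs w

syntax ∑ xs (λ x → e) = ∑[ x ← xs ] e

module _ {a} {A : Set a} where

  ∑-cong∈ : ∀ {f g : A → ℕ} xs → (∀ x → x ∈ xs → f x ≡ g x) → ∑ xs f ≡ ∑ xs g
  ∑-cong∈ []       h = refl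
  ∑-cong∈ (x ∷ xs) h = cong₂ _+_ (h x (here refl)) (∑-cong∈ xs (λ y y∈ → h y (there y∈)))

  ∑-cong : ∀ {f g : A → ℕ} xs → (∀ x → f x ≡ g x) → ∑ xs f ≡ ∑ xs g
  ∑-cong xs h = ∑-cong∈ xs (λ x _ → h x)

  ∑-zero : ∀ (xs : List A) → ∑[ x ← xs ] 0 ≡ 0
  ∑-zero []       = refl
  ∑-zero (x ∷ xs) = ∑-zero xs

  ∑-+ : ∀ (f g : A → ℕ) xs → ∑[ x ← xs ] (f x + g x) ≡ ∑ xs f + ∑ xs g
  ∑-+ f g []       = refl
  ∑-+ f g (x ∷ xs) = trans (cong (f x + g x +_) (∑-+ f g xs)) (+-interchange (f x) (g x) (∑ xs f) (∑ xs g))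

  ∑-*ˡ : ∀ c (f : A → ℕ) xs → ∑[ x ← xs ] (c * f x) ≡ c * ∑ xs f
  ∑-*ˡ c f []       = sym (*-zeroʳ c)
  ∑-*ˡ c f (x ∷ xs) = trans (cong (c * f x +_) (∑-*ˡ c f xs)) (sym (*-distribˡ-+ c (f x) (∑ xs f)))

  ∑-const : ∀ c (xs : List A) → ∑[ x ← xs ] c ≡ c * length xs
  ∑-const c []       = sym (*-zeroʳ c)
  ∑-const c (x ∷ xs) = trans (cong (c +_) (∑-const c xs)) (sym (*-suc c (length xs)))

  length≡∑1 : ∀ (xs : List A) → length xs ≡ ∑[ x ← xs ] 1
  length≡∑1 xs = trans (sym (*-identityˡ (length xs))) (sym (∑-const 1 xs))

  ∑-++ : ∀ (w : A → ℕ) xs ys → ∑ (xs ++ ys) w ≡ ∑ xs w + ∑ ys w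
  ∑-++ w []       ys = refl
  ∑-++ w (x ∷ xs) ys = trans (cong (w x +_) (∑-++ w xs ys)) (sym (+-assoc (w x) (∑ xs w) (∑ ys w)))

  length-filter≡∑ : ∀ {p} {P : A → Set p} (P? : Decidable P) xs → length (filter P? xs) ≡ ∑[ x ← xs ] ⟦ P? x ⟧
  length-filter≡∑ P? []       = refl
  length-filter≡∑ P? (x ∷ xs) with does (P? x)
  ... | false = length-filter≡∑ P? xs
  ... | true  = cong suc (length-filter≡∑ P? xs)

module _ {a b} {A : Set a} {B : Set b} where

  ∑-map : ∀ (w : B → ℕ) (f : A → B) xs → ∑ (map f xs) w ≡ ∑[ x ← xs ] w (f x)
  ∑-map w f []       = refl
  ∑-map w f (x ∷ xs) = cong (w (f x) +_) (∑-map w f xs)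

  ∑-concatMap : ∀ (w : B → ℕ) (f : A → List B) xs → ∑ (concatMap f xs) w ≡ ∑[ x ← xs ] ∑ (f x) w
  ∑-concatMap w f []       = refl
  ∑-concatMap w f (x ∷ xs) = trans (∑-++ w (f x) (concatMap f xs)) (cong (∑ (f x) w +_) (∑-concatMap w f xs))

  ∑-swap : ∀ (w : A → B → ℕ) xs ys → ∑[ x ← xs ] ∑[ y ← ys ] w x y ≡ ∑[ y ← ys ] ∑[ x ← xs ] w x y
  ∑-swap w []       ys = sym (∑-zero ys)
  ∑-swap w (x ∷ xs) ys = trans (cong (∑ ys (w x) +_) (∑-swap w xs ys)) (sym (∑-+ (w x) _ ys))

-- Enumerations: lists containing every element of a type exactly once.
-- Sums over any two enumerations agree, which lets us reindex along bijections.
module Enumeration {a} {A : Set a} (_≟_ : DecidableEquality A) where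

  multiplicity : A → List A → ℕ
  multiplicity a xs = ∑[ x ← xs ] ⟦ x ≟ a ⟧

  IsEnumeration : List A → Set a
  IsEnumeration xs = ∀ a → multiplicity a xs ≡ 1

  ∈⇒multiplicity-pos : ∀ {a} xs → a ∈ xs → 1 ≤ multiplicity a xs
  ∈⇒multiplicity-pos {a} (x ∷ xs) (here refl) = ≤-trans (≤-reflexive (sym (⟦⟧-yes (a ≟ a) refl))) (m≤m+n _ _)
  ∈⇒multiplicity-pos {a} (x ∷ xs) (there a∈) = ≤-trans (∈⇒multiplicity-pos xs a∈) (m≤n+m _ _)

  multiplicity-pos⇒∈ : ∀ {a} xs → 1 ≤ multiplicity a xs → a ∈ xs
  multiplicity-pos⇒∈ {a} (x ∷ xs) pos with x ≟ a
  ... | yes refl = here refl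
  ... | no  _    = there (multiplicity-pos⇒∈ xs pos)

  enumeration-complete : ∀ {xs} → IsEnumeration xs → ∀ a → a ∈ xs
  enumeration-complete {xs} enum a = multiplicity-pos⇒∈ xs (≤-reflexive (sym (enum a)))

  ⟦≟⟧-sym : ∀ x y → ⟦ x ≟ y ⟧ ≡ ⟦ y ≟ x ⟧
  ⟦≟⟧-sym x y = ⟦⟧-cong (x ≟ y) (y ≟ x) sym sym

  ∑-pick : ∀ (w : A → ℕ) a xs → ∑[ x ← xs ] (w x * ⟦ x ≟ a ⟧) ≡ w a * multiplicity a xs
  ∑-pick w a xs = trans (∑-cong xs pointwise) (∑-*ˡ (w a) (λ x → ⟦ x ≟ a ⟧) xs)
    where
    pointwise : ∀ x → w x * ⟦ x ≟ a ⟧ ≡ w a * ⟦ x ≟ a ⟧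
    pointwise x with x ≟ a
    ... | yes refl = refl
    ... | no  _    = trans (*-zeroʳ (w x)) (sym (*-zeroʳ (w a)))

  ∑-enumeration : ∀ {xs ys} → IsEnumeration xs → IsEnumeration ys → ∀ w → ∑ xs w ≡ ∑ ys w
  ∑-enumeration {xs} {ys} enum-xs enum-ys w = begin
    ∑[ x ← xs ] w x
      ≡⟨ ∑-cong xs (λ x → sym (trans (cong (w x *_) (enum-ys x)) (*-identityʳ (w x)))) ⟩
    ∑[ x ← xs ] (w x * multiplicity x ys)
      ≡⟨ ∑-cong xs (λ x → sym (∑-*ˡ (w x) (λ y → ⟦ y ≟ x ⟧) ys)) ⟩
    ∑[ x ← xs ] ∑[ y ← ys ] (w x * ⟦ y ≟ x ⟧)
      ≡⟨ ∑-swap (λ x y → w x * ⟦ y ≟ x ⟧) xs ys ⟩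
    ∑[ y ← ys ] ∑[ x ← xs ] (w x * ⟦ y ≟ x ⟧)
      ≡⟨ ∑-cong ys (λ y → ∑-cong xs (λ x → cong (w x *_) (⟦≟⟧-sym y x))) ⟩
    ∑[ y ← ys ] ∑[ x ← xs ] (w x * ⟦ x ≟ y ⟧)
      ≡⟨ ∑-cong ys (λ y → ∑-pick w y xs) ⟩
    ∑[ y ← ys ] (w y * multiplicity y xs)
      ≡⟨ ∑-cong ys (λ y → trans (cong (w y *_) (enum-xs y)) (*-identityʳ (w y))) ⟩
    ∑[ y ← ys ] w y
      ∎
    where open ≡-Reasoning

  ∑-reindex : ∀ {xs} (f g : A → A) → (∀ x → g (f x) ≡ x) → (∀ y → f (g y) ≡ y) →
              IsEnumeration xs → ∀ w → ∑[ x ← xs ] w (f x) ≡ ∑ xs w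
  ∑-reindex {xs} f g gf fg enum w =
    trans (sym (∑-map w f xs)) (∑-enumeration {map f xs} {xs} map-enumeration enum w)
    where
    -- f x = a exactly when x = g a.
    map-enumeration : IsEnumeration (map f xs)
    map-enumeration a = trans (∑-map (λ y → ⟦ y ≟ a ⟧) f xs)
      (trans (∑-cong xs (λ x → ⟦⟧-cong (f x ≟ a) (x ≟ g a)
                                  (λ e → trans (sym (gf x)) (cong g e)) (λ e → trans (cong f e) (fg a))))
             (enum (g a)))

open Enumeration

∑-allFin-suc : ∀ n (w : Fin (suc n) → ℕ) → ∑ (allFin (suc n)) w ≡ w F.zero + ∑[ i ← allFin n ] w (F.suc i)
∑-allFin-suc n w = cong (w F.zero +_) (trans (cong (λ l → ∑ l w) (sym (LP.map-tabulate id F.suc))) (∑-map w F.suc (allFin n)))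

allFin-enumeration : ∀ n → IsEnumeration FP._≟_ (allFin n)
allFin-enumeration (suc n) F.zero = begin
  ∑[ i ← allFin (suc n) ] ⟦ i FP.≟ F.zero ⟧
    ≡⟨ ∑-allFin-suc n (λ i → ⟦ i FP.≟ F.zero ⟧) ⟩
  1 + ∑[ i ← allFin n ] ⟦ F.suc i FP.≟ F.zero ⟧
    ≡⟨ cong suc (∑-cong (allFin n) (λ i → ⟦⟧-no (F.suc i FP.≟ F.zero) λ ())) ⟩
  1 + ∑[ i ← allFin n ] 0
    ≡⟨ cong suc (∑-zero (allFin n)) ⟩
  1
    ∎
  where open ≡-Reasoning
allFin-enumeration (suc n) (F.suc a) = begin
  ∑[ i ← allFin (suc n) ] ⟦ i FP.≟ F.suc a ⟧
    ≡⟨ ∑-allFin-suc n (λ i → ⟦ i FP.≟ F.suc a ⟧) ⟩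
  ∑[ i ← allFin n ] ⟦ F.suc i FP.≟ F.suc a ⟧
    ≡⟨ ∑-cong (allFin n) (λ i → ⟦⟧-cong (F.suc i FP.≟ F.suc a) (i FP.≟ a) FP.suc-injective (cong F.suc)) ⟩
  ∑[ i ← allFin n ] ⟦ i FP.≟ a ⟧
    ≡⟨ allFin-enumeration n a ⟩
  1
    ∎
  where open ≡-Reasoning

⟦≟∷⟧ : ∀ {a} {A : Set a} (_≟_ : DecidableEquality A) {k} (x y : A) (u v : Vec A k) →
       ⟦ VP.≡-dec _≟_ (x V.∷ u) (y V.∷ v) ⟧ ≡ ⟦ x ≟ y ⟧ * ⟦ VP.≡-dec _≟_ u v ⟧
⟦≟∷⟧ _≟_ x y u v =
  trans (⟦⟧-cong (VP.≡-dec _≟_ (x V.∷ u) (y V.∷ v)) ((x ≟ y) ×-dec VP.≡-dec _≟_ u v) VP.∷-injective (λ { (refl , refl) → refl }))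
        (⟦⟧-× (x ≟ y) (VP.≡-dec _≟_ u v))

vec-ext : ∀ {a} {A : Set a} {k} (u v : Vec A k) → (∀ i → lookup u i ≡ lookup v i) → u ≡ v
vec-ext u v h = trans (sym (VP.tabulate∘lookup u)) (trans (VP.tabulate-cong h) (VP.tabulate∘lookup v))

allVec-enumeration : ∀ {a} {A : Set a} (_≟_ : DecidableEquality A) {xs : List A} →
                     IsEnumeration _≟_ xs → ∀ k → IsEnumeration (VP.≡-dec _≟_) (allVec k xs)
allVec-enumeration _≟_ enum zero    V.[] = refl
allVec-enumeration _≟_ {xs} enum (suc k) (y V.∷ v) = begin
  ∑[ u ← allVec (suc k) xs ] ⟦ u ≟ᵥ (y V.∷ v) ⟧
    ≡⟨ ∑-concatMap _ (λ x → map (x V.∷_) (allVec k xs)) xs ⟩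
  ∑[ x ← xs ] ∑ (map (x V.∷_) (allVec k xs)) (λ u → ⟦ u ≟ᵥ (y V.∷ v) ⟧)
    ≡⟨ ∑-cong xs (λ x → ∑-map _ (x V.∷_) (allVec k xs)) ⟩
  ∑[ x ← xs ] ∑[ u ← allVec k xs ] ⟦ (x V.∷ u) ≟ᵥ (y V.∷ v) ⟧
    ≡⟨ ∑-cong xs (λ x → ∑-cong (allVec k xs) (λ u → ⟦≟∷⟧ _≟_ x y u v)) ⟩
  ∑[ x ← xs ] ∑[ u ← allVec k xs ] (⟦ x ≟ y ⟧ * ⟦ u ≟ᵥ v ⟧)
    ≡⟨ ∑-cong xs (λ x → ∑-*ˡ ⟦ x ≟ y ⟧ _ (allVec k xs)) ⟩
  ∑[ x ← xs ] (⟦ x ≟ y ⟧ * multiplicity _≟ᵥ_ v (allVec k xs))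
    ≡⟨ ∑-cong xs (λ x → trans (cong (⟦ x ≟ y ⟧ *_) (allVec-enumeration _≟_ enum k v)) (*-identityʳ _)) ⟩
  ∑[ x ← xs ] ⟦ x ≟ y ⟧
    ≡⟨ enum y ⟩
  1
    ∎
  where
  open ≡-Reasoning
  _≟ᵥ_ : ∀ {m} → DecidableEquality (Vec _ m)
  _≟ᵥ_ = VP.≡-dec _≟_

-- An injective endomap of Fin n is surjective: if it missed y, punching y out
-- would give an injection Fin n → Fin (n - 1), contradicting the pigeonhole principle.
injective⇒surjective : ∀ {n} {f : Fin n → Fin n} → Injective _≡_ _≡_ f → ∀ y → ∃ λ x → f x ≡ y
injective⇒surjective {suc m} {f} f-inj y with FP.any? (λ x → f x FP.≟ y)
... | yes hit = hit
... | no miss with FP.pigeonhole (n<1+n m) (λ x → punchOut {i = y} {j = f x} (λ e → miss (x , sym e)))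
... | i , j , i<j , same =
  ⊥-elim (FP.<-irrefl (f-inj (FP.punchOut-injective (λ e → miss (i , sym e)) (λ e → miss (j , sym e)) same)) i<j)

module Inverse {n} (f : Fin n → Fin n) (f-inj : Injective _≡_ _≡_ f) where

  f⁻¹ : Fin n → Fin n
  f⁻¹ y = proj₁ (injective⇒surjective f-inj y)

  f∘f⁻¹ : ∀ y → f (f⁻¹ y) ≡ y
  f∘f⁻¹ y = proj₂ (injective⇒surjective f-inj y)

  f⁻¹∘f : ∀ x → f⁻¹ (f x) ≡ x
  f⁻¹∘f x = f-inj (f∘f⁻¹ (f x))

  f⁻¹-injective : Injective _≡_ _≡_ f⁻¹
  f⁻¹-injective {y} {y′} e = trans (sym (f∘f⁻¹ y)) (trans (cong f e) (f∘f⁻¹ y′))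

StrictlyIncreasing : ∀ {n} → (Fin n → Fin n) → Set
StrictlyIncreasing f = ∀ i j → i F.< j → f i F.< f j

strictlyIncreasing⇒injective : ∀ {n} {f : Fin n → Fin n} → StrictlyIncreasing f → Injective _≡_ _≡_ f
strictlyIncreasing⇒injective {f = f} mono {i} {j} e with FP.<-cmp i j
... | tri< i<j _ _ = ⊥-elim (FP.<-irrefl e (mono i j i<j))
... | tri≈ _ i≡j _ = i≡j
... | tri> _ _ j<i = ⊥-elim (FP.<-irrefl (sym e) (mono j i j<i))

-- By strong
-- induction on i: f is onto, so i = f j for some j; j < i is impossible as then
-- f j = j, and if i < j then f i < i, whence f (f i) = f i and so f i = i.
strictlyIncreasing⇒id : ∀ {n} {f : Fin n → Fin n} → StrictlyIncreasing f → ∀ i → f i ≡ i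
strictlyIncreasing⇒id {f = f} mono i = fixed i (<-wellFounded i)
  where
  f-inj : Injective _≡_ _≡_ f
  f-inj = strictlyIncreasing⇒injective mono
  fixed : ∀ i → Acc F._<_ i → f i ≡ i
  fixed i (acc below) with injective⇒surjective f-inj i
  ... | j , fj≡i with FP.<-cmp j i
  ... | tri≈ _ refl _ = fj≡i
  ... | tri< j<i _ _ = ⊥-elim (FP.<-irrefl (trans (sym (fixed j (below j<i))) fj≡i) j<i)
  ... | tri> _ _ i<j = f-inj (fixed (f i) (below fi<i))
    where
    fi<i : f i F.< i
    fi<i = subst (f i F.<_) fj≡i (mono i j i<j)

IsInjection : ∀ {k m} → Vec (Fin m) k → Set
IsInjection v = Injective _≡_ _≡_ (lookup v)

isInjection? : ∀ {k m} (v : Vec (Fin m) k) → Dec (IsInjection v)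
isInjection? v = map′ (λ h {i} {j} → h i j) (λ h i j → h)
  (FP.all? (λ i → FP.all? (λ j → (lookup v i FP.≟ lookup v j) →-dec (i FP.≟ j))))

_≟ᵥ_ : ∀ {k m} → DecidableEquality (Vec (Fin m) k)
_≟ᵥ_ = VP.≡-dec FP._≟_

extend : ∀ {k m} → Fin (suc m) → Vec (Fin m) k → Vec (Fin (suc m)) (suc k)
extend x u = x V.∷ V.map (punchIn x) u

-- injections k m lists the injections Fin k → Fin m: a first value x followed by
-- an injection into the remaining m values, relabelled by punchIn x.
injections : ∀ k m → List (Vec (Fin m) k)
injections zero    m       = V.[] ∷ []
injections (suc k) zero    = []
injections (suc k) (suc m) = concatMap (λ x → map (extend x) (injections k m)) (allFin (suc m))

length-injections : ∀ n → length (injections n n) ≡ n !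
length-injections zero    = refl
length-injections (suc n) = begin
  length (injections (suc n) (suc n))
    ≡⟨ length≡∑1 (injections (suc n) (suc n)) ⟩
  ∑[ v ← injections (suc n) (suc n) ] 1
    ≡⟨ ∑-concatMap (λ _ → 1) (λ x → map (extend x) (injections n n)) (allFin (suc n)) ⟩
  ∑[ x ← allFin (suc n) ] ∑ (map (extend x) (injections n n)) (λ _ → 1)
    ≡⟨ ∑-cong (allFin (suc n)) (λ x → ∑-map (λ _ → 1) (extend x) (injections n n)) ⟩
  ∑[ x ← allFin (suc n) ] ∑[ u ← injections n n ] 1
    ≡⟨ ∑-cong (allFin (suc n)) (λ _ → trans (sym (length≡∑1 (injections n n))) (length-injections n)) ⟩
  ∑[ x ← allFin (suc n) ] (n !)
    ≡⟨ ∑-const (n !) (allFin (suc n)) ⟩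
  n ! * length (allFin (suc n))
    ≡⟨ cong (n ! *_) (LP.length-tabulate id) ⟩
  n ! * suc n
    ≡⟨ *-comm (n !) (suc n) ⟩
  suc n !
    ∎
  where open ≡-Reasoning

-- punchIn y never produces y, so a vector containing y is not of the form map (punchIn y) u.
map-punchIn≢ : ∀ {k m} y (u : Vec (Fin m) k) (w : Vec (Fin (suc m)) k) i → lookup w i ≡ y → V.map (punchIn y) u ≢ w
map-punchIn≢ y u w i wi≡y e = FP.punchInᵢ≢i y (lookup u i)
  (trans (sym (VP.lookup-map i (punchIn y) u)) (trans (cong (λ z → lookup z i) e) wi≡y))

module AvoidingValue {k m} (y : Fin (suc m)) (w : Vec (Fin (suc m)) k) (y∉w : ∀ i → lookup w i ≢ y) where

  -- The unique u with map (punchIn y) u ≡ w.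
  w′ : Vec (Fin m) k
  w′ = V.tabulate (λ i → punchOut (y∉w i ∘ sym))

  punchIn-w′ : ∀ i → punchIn y (lookup w′ i) ≡ lookup w i
  punchIn-w′ i = trans (cong (punchIn y) (VP.lookup∘tabulate _ i)) (FP.punchIn-punchOut _)

  preimage⇒ : ∀ u → V.map (punchIn y) u ≡ w → u ≡ w′
  preimage⇒ u e = vec-ext u w′ (λ i → FP.punchIn-injective y _ _
    (trans (sym (VP.lookup-map i (punchIn y) u)) (trans (cong (λ z → lookup z i) e) (sym (punchIn-w′ i)))))

  preimage⇐ : ∀ u → u ≡ w′ → V.map (punchIn y) u ≡ w
  preimage⇐ u refl = vec-ext _ w (λ i → trans (VP.lookup-map i (punchIn y) w′) (punchIn-w′ i))

  injection⇒ : IsInjection (y V.∷ w) → IsInjection w′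
  injection⇒ inj {i} {j} e =
    FP.suc-injective (inj {F.suc i} {F.suc j} (trans (sym (punchIn-w′ i)) (trans (cong (punchIn y) e) (punchIn-w′ j))))

  injection⇐ : IsInjection w′ → IsInjection (y V.∷ w)
  injection⇐ inj {F.zero}  {F.zero}  e = refl
  injection⇐ inj {F.zero}  {F.suc j} e = ⊥-elim (y∉w j (sym e))
  injection⇐ inj {F.suc i} {F.zero}  e = ⊥-elim (y∉w i e)
  injection⇐ inj {F.suc i} {F.suc j} e =
    cong F.suc (inj (FP.punchIn-injective y _ _ (trans (punchIn-w′ i) (trans e (sym (punchIn-w′ j))))))

multiplicity-injections : ∀ k m (v : Vec (Fin m) k) → multiplicity _≟ᵥ_ v (injections k m) ≡ ⟦ isInjection? v ⟧
multiplicity-injections zero    m       V.[] = sym (⟦⟧-yes (isInjection? {zero} {m} V.[]) (λ { {()} }))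
multiplicity-injections (suc k) zero    (() V.∷ w)
multiplicity-injections (suc k) (suc m) (y V.∷ w) = begin
  multiplicity _≟ᵥ_ (y V.∷ w) (injections (suc k) (suc m))
    ≡⟨ ∑-concatMap _ (λ x → map (extend x) (injections k m)) (allFin (suc m)) ⟩
  ∑[ x ← allFin (suc m) ] ∑ (map (extend x) (injections k m)) (λ v → ⟦ v ≟ᵥ (y V.∷ w) ⟧)
    ≡⟨ ∑-cong (allFin (suc m)) (λ x → ∑-map _ (extend x) (injections k m)) ⟩
  ∑[ x ← allFin (suc m) ] ∑[ u ← injections k m ] ⟦ extend x u ≟ᵥ (y V.∷ w) ⟧
    ≡⟨ ∑-cong (allFin (suc m)) (λ x → ∑-cong (injections k m) (λ u → ⟦≟∷⟧ FP._≟_ x y (V.map (punchIn x) u) w)) ⟩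
  ∑[ x ← allFin (suc m) ] ∑[ u ← injections k m ] (⟦ x FP.≟ y ⟧ * ⟦ V.map (punchIn x) u ≟ᵥ w ⟧)
    ≡⟨ ∑-cong (allFin (suc m)) (λ x → trans (∑-*ˡ ⟦ x FP.≟ y ⟧ _ (injections k m)) (*-comm ⟦ x FP.≟ y ⟧ _)) ⟩
  ∑[ x ← allFin (suc m) ] (preimages x * ⟦ x FP.≟ y ⟧)
    ≡⟨ ∑-pick FP._≟_ preimages y (allFin (suc m)) ⟩
  preimages y * multiplicity FP._≟_ y (allFin (suc m))
    ≡⟨ trans (cong (preimages y *_) (allFin-enumeration (suc m) y)) (*-identityʳ (preimages y)) ⟩
  preimages y
    ≡⟨ preimages-y (FP.any? (λ i → lookup w i FP.≟ y)) ⟩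
  ⟦ isInjection? (y V.∷ w) ⟧
    ∎
  where
  open ≡-Reasoning
  preimages : Fin (suc m) → ℕ
  preimages x = ∑[ u ← injections k m ] ⟦ V.map (punchIn x) u ≟ᵥ w ⟧
  -- If y occurs in w, both sides vanish; otherwise use the induction hypothesis on w′.
  preimages-y : Dec (∃ λ i → lookup w i ≡ y) → preimages y ≡ ⟦ isInjection? (y V.∷ w) ⟧
  preimages-y (yes (i , wi≡y)) = begin
    preimages y
      ≡⟨ ∑-cong (injections k m) (λ u → ⟦⟧-no (V.map (punchIn y) u ≟ᵥ w) (map-punchIn≢ y u w i wi≡y)) ⟩
    ∑[ u ← injections k m ] 0
      ≡⟨ ∑-zero (injections k m) ⟩
    0
      ≡⟨ ⟦⟧-no (isInjection? (y V.∷ w)) (λ inj → FP.0≢1+n (inj {F.zero} {F.suc i} (sym wi≡y))) ⟨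
    ⟦ isInjection? (y V.∷ w) ⟧
      ∎
  preimages-y (no y∉w) = begin
    preimages y
      ≡⟨ ∑-cong (injections k m) (λ u → ⟦⟧-cong (V.map (punchIn y) u ≟ᵥ w) (u ≟ᵥ w′) (preimage⇒ u) (preimage⇐ u)) ⟩
    multiplicity _≟ᵥ_ w′ (injections k m)
      ≡⟨ multiplicity-injections k m w′ ⟩
    ⟦ isInjection? w′ ⟧
      ≡⟨ ⟦⟧-cong (isInjection? w′) (isInjection? (y V.∷ w)) injection⇐ injection⇒ ⟩
    ⟦ isInjection? (y V.∷ w) ⟧
      ∎
    where open AvoidingValue y w (λ i e → y∉w (i , e))

∈-injections⇒injection : ∀ {k m} {v : Vec (Fin m) k} → v ∈ injections k m → IsInjection v
∈-injections⇒injection {k} {m} {v} v∈ = ⟦⟧-pos (isInjection? v)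
  (≤-trans (∈⇒multiplicity-pos _≟ᵥ_ (injections k m) v∈) (≤-reflexive (multiplicity-injections k m v)))

-- IsPerm, Increasing and OrderIso quantify twice over allFin k: they are binary ∀s.
All²⇒∀ : ∀ {k} {R : Fin k → Fin k → Set} → All (λ i → All (R i) (allFin k)) (allFin k) → ∀ i j → R i j
All²⇒∀ a i j = All.lookup (All.lookup a (∈-allFin i)) (∈-allFin j)

∀⇒All² : ∀ {k} {R : Fin k → Fin k → Set} → (∀ i j → R i j) → All (λ i → All (R i) (allFin k)) (allFin k)
∀⇒All² h = All.tabulate (λ {i} _ → All.tabulate (λ {j} _ → h i j))

isPerm⇒injection : ∀ {n} {π : Vec (Fin n) n} → IsPerm π → IsInjection π
isPerm⇒injection p {i} {j} = All²⇒∀ p i j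

-- A pattern of length n occurs in a word of length n only as the whole word:
-- the positions must be 0,1,…,n-1, and then v ∘ π⁻¹ is strictly increasing.
contains⇒≡ : ∀ {n} (π v : Vec (Fin n) n) → IsInjection π → Contains π v → v ≡ π
contains⇒≡ {n} π v π-inj c with Any.satisfied c
... | f , f-increasing , order-iso = vec-ext v π v≗π
  where
  open Inverse (lookup π) π-inj renaming (f⁻¹ to π⁻¹; f∘f⁻¹ to π∘π⁻¹; f⁻¹∘f to π⁻¹∘π)
  f≗id : ∀ i → lookup f i ≡ i
  f≗id = strictlyIncreasing⇒id (All²⇒∀ f-increasing)
  order-preserved : ∀ i j → lookup π i F.< lookup π j → lookup v i F.< lookup v j
  order-preserved i j = subst₂ (λ a b → lookup π i F.< lookup π j → lookup v a F.< lookup v b)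
                               (f≗id i) (f≗id j) (proj₁ (All²⇒∀ order-iso i j))
  v∘π⁻¹-increasing : StrictlyIncreasing (lookup v ∘ π⁻¹)
  v∘π⁻¹-increasing a b a<b = order-preserved (π⁻¹ a) (π⁻¹ b) (subst₂ F._<_ (sym (π∘π⁻¹ a)) (sym (π∘π⁻¹ b)) a<b)
  v≗π : ∀ i → lookup v i ≡ lookup π i
  v≗π i = trans (cong (lookup v) (sym (π⁻¹∘π i))) (strictlyIncreasing⇒id v∘π⁻¹-increasing (lookup π i))

contains-self : ∀ {n} (π : Vec (Fin n) n) → Contains π π
contains-self {n} π = lose identity∈ (∀⇒All² increasing , ∀⇒All² order-iso)
  where
  identity∈ : V.allFin n ∈ allVec n (allFin n)
  identity∈ = enumeration-complete _≟ᵥ_ (allVec-enumeration FP._≟_ (allFin-enumeration n) n) (V.allFin n)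
  increasing : ∀ i j → i F.< j → lookup (V.allFin n) i F.< lookup (V.allFin n) j
  increasing i j i<j rewrite VP.lookup-allFin i | VP.lookup-allFin j = i<j
  order-iso : ∀ i j → (lookup π i F.< lookup π j → lookup π (lookup (V.allFin n) i) F.< lookup π (lookup (V.allFin n) j))
                    × (lookup π (lookup (V.allFin n) i) F.< lookup π (lookup (V.allFin n) j) → lookup π i F.< lookup π j)
  order-iso i j rewrite VP.lookup-allFin i | VP.lookup-allFin j = id , id

avoids⇔≢ : ∀ {n} (π v : Vec (Fin n) n) → IsInjection π → (¬ Contains π v → v ≢ π) × (v ≢ π → ¬ Contains π v)
avoids⇔≢ π v π-inj = (λ { ¬c refl → ¬c (contains-self π) }) , (λ v≢π c → v≢π (contains⇒≡ π v π-inj c))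

entry : ∀ {a} {A : Set a} {m n} → Vec (Vec A n) m → Fin m → Fin n → A
entry g i j = lookup (lookup g i) j

grid-ext : ∀ {a} {A : Set a} {m n} (g h : Vec (Vec A n) m) → (∀ i j → entry g i j ≡ entry h i j) → g ≡ h
grid-ext g h e = vec-ext g h (λ i → vec-ext _ _ (e i))

lookup-transpose : ∀ {a} {A : Set a} {m n} (as : Vec A n) (ass : Vec (Vec A n) m) (j : Fin n) →
                   lookup (transpose (as V.∷ ass)) j ≡ lookup as j V.∷ lookup (transpose ass) j
lookup-transpose {n = n} as ass j =
  trans (VP.lookup-⊛ j (V.replicate n V._∷_ V.⊛ as) (transpose ass))
    (cong (λ f → f (lookup (transpose ass) j))
          (trans (VP.lookup-⊛ j (V.replicate n V._∷_) as) (cong (λ f → f (lookup as j)) (VP.lookup-replicate j V._∷_))))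

entry-transpose : ∀ {a} {A : Set a} {m n} (g : Vec (Vec A n) m) i j → entry (transpose g) j i ≡ entry g i j
entry-transpose (as V.∷ ass) F.zero    j = cong (λ z → lookup z F.zero) (lookup-transpose as ass j)
entry-transpose (as V.∷ ass) (F.suc i) j =
  trans (cong (λ z → lookup z (F.suc i)) (lookup-transpose as ass j)) (entry-transpose ass i j)

All-toList⇒∀ : ∀ {a p} {A : Set a} {P : A → Set p} {k} (v : Vec A k) → All P (toList v) → ∀ i → P (lookup v i)
All-toList⇒∀ (x V.∷ v) (px ∷ _)  F.zero    = px
All-toList⇒∀ (x V.∷ v) (_  ∷ pv) (F.suc i) = All-toList⇒∀ v pv i

∀⇒All-toList : ∀ {a p} {A : Set a} {P : A → Set p} {k} (v : Vec A k) → (∀ i → P (lookup v i)) → All P (toList v)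
∀⇒All-toList V.[]       h = []
∀⇒All-toList (x V.∷ v) h = h F.zero ∷ ∀⇒All-toList v (h ∘ F.suc)

IsLatinTable : ∀ {n} → (Fin n → Fin n → Fin n) → Set
IsLatinTable e = (∀ i → Injective _≡_ _≡_ (e i)) × (∀ j → Injective _≡_ _≡_ (λ i → e i j))

isLatin⇒ : ∀ {n} (g : Grid n) → IsLatin g → IsLatinTable (entry g)
isLatin⇒ g (rows , columns) =
  (λ i {j} {j′} → All²⇒∀ (All-toList⇒∀ g rows i) j j′) ,
  (λ j {i} {i′} e → All²⇒∀ (All-toList⇒∀ (transpose g) columns j) i i′
                      (trans (entry-transpose g i j) (trans e (sym (entry-transpose g i′ j)))))

isLatin⇐ : ∀ {n} (g : Grid n) → IsLatinTable (entry g) → IsLatin g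
isLatin⇐ g (rows , columns) =
  ∀⇒All-toList g (λ i → ∀⇒All² (λ j j′ → rows i)) ,
  ∀⇒All-toList (transpose g) (λ j → ∀⇒All² (λ i i′ e →
    columns j (trans (sym (entry-transpose g i j)) (trans e (entry-transpose g i′ j)))))

RowsAvoid : ∀ {n} → (Fin n → Fin n) → (Fin n → Fin n → Fin n) → (Fin n → Fin n) → Set
RowsAvoid w e σ = ∀ a → ¬ (∀ j → e a (σ j) ≡ w j)

rowsAvoid? : ∀ {n} (w : Fin n → Fin n) e σ → Dec (RowsAvoid w e σ)
rowsAvoid? w e σ = FP.all? (λ a → ¬? (FP.all? (λ j → e a (σ j) FP.≟ w j)))

avoids⇒ : ∀ {n} (π : Vec (Fin n) n) (g : Grid n) → IsInjection π → Avoids π g →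
          RowsAvoid (lookup π) (entry g) id × RowsAvoid (lookup π) (flip (entry g)) id
avoids⇒ π g π-inj (rows , columns) =
  (λ i row≗π → proj₁ (avoids⇔≢ π (lookup g i) π-inj) (All-toList⇒∀ g rows i) (vec-ext _ π row≗π)) ,
  (λ j column≗π → proj₁ (avoids⇔≢ π (lookup (transpose g) j) π-inj) (All-toList⇒∀ (transpose g) columns j)
                    (vec-ext _ π (λ i → trans (entry-transpose g i j) (column≗π i))))

avoids⇐ : ∀ {n} (π : Vec (Fin n) n) (g : Grid n) → IsInjection π →
          RowsAvoid (lookup π) (entry g) id × RowsAvoid (lookup π) (flip (entry g)) id → Avoids π g
avoids⇐ π g π-inj (rows , columns) =
  ∀⇒All-toList g (λ i → proj₂ (avoids⇔≢ π (lookup g i) π-inj) (λ { refl → rows i (λ j → refl) })) ,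
  ∀⇒All-toList (transpose g) (λ j → proj₂ (avoids⇔≢ π (lookup (transpose g) j) π-inj)
    (λ column≡π → columns j (λ i → trans (sym (entry-transpose g i j)) (cong (λ z → lookup z i) column≡π))))

relabel : ∀ {n} → (Fin n → Fin n) → (Fin n → Fin n) → Grid n → Grid n
relabel ρ τ g = V.tabulate (λ i → V.tabulate (λ j → entry g (ρ i) (τ j)))

entry-relabel : ∀ {n} ρ τ (g : Grid n) i j → entry (relabel ρ τ g) i j ≡ entry g (ρ i) (τ j)
entry-relabel ρ τ g i j = trans (cong (λ z → lookup z j) (VP.lookup∘tabulate _ i)) (VP.lookup∘tabulate _ j)

relabel-inverse : ∀ {n} (ρ ρ′ τ τ′ : Fin n → Fin n) → (∀ i → ρ (ρ′ i) ≡ i) → (∀ j → τ (τ′ j) ≡ j) →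
                  ∀ g → relabel ρ′ τ′ (relabel ρ τ g) ≡ g
relabel-inverse ρ ρ′ τ τ′ ρρ′ ττ′ g = grid-ext _ g (λ i j → begin
  entry (relabel ρ′ τ′ (relabel ρ τ g)) i j ≡⟨ entry-relabel ρ′ τ′ (relabel ρ τ g) i j ⟩
  entry (relabel ρ τ g) (ρ′ i) (τ′ j)       ≡⟨ entry-relabel ρ τ g (ρ′ i) (τ′ j) ⟩
  entry g (ρ (ρ′ i)) (τ (τ′ j))             ≡⟨ cong₂ (entry g) (ρρ′ i) (ττ′ j) ⟩
  entry g i j                               ∎)
  where open ≡-Reasoning

relabel-latin : ∀ {n} {ρ τ : Fin n → Fin n} (g : Grid n) → Injective _≡_ _≡_ ρ → Injective _≡_ _≡_ τ →
                IsLatinTable (entry g) → IsLatinTable (entry (relabel ρ τ g))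
relabel-latin {ρ = ρ} {τ} g ρ-inj τ-inj (rows , columns) =
  (λ i e → τ-inj (rows (ρ i) (trans (sym (entry-relabel ρ τ g i _)) (trans e (entry-relabel ρ τ g i _))))) ,
  (λ j e → ρ-inj (columns (τ j) (trans (sym (entry-relabel ρ τ g _ j)) (trans e (entry-relabel ρ τ g _ j)))))

-- If e′ i j = e (ρ i) (σ j), the rows of e′ avoid w iff the rows of e read along
-- σ do; the forward direction needs every row of e to be some ρ i.
rowsAvoid-permute⇒ : ∀ {n} (w : Fin n → Fin n) (e e′ : Fin n → Fin n → Fin n) (ρ σ : Fin n → Fin n) →
  (∀ a → ∃ λ i → ρ i ≡ a) → (∀ i j → e′ i j ≡ e (ρ i) (σ j)) → RowsAvoid w e′ id → RowsAvoid w e σ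
rowsAvoid-permute⇒ w e e′ ρ σ ρ-onto e′≗ avoid a spells with ρ-onto a
... | i , refl = avoid i (λ j → trans (e′≗ i j) (spells j))

rowsAvoid-permute⇐ : ∀ {n} (w : Fin n → Fin n) (e e′ : Fin n → Fin n → Fin n) (ρ σ : Fin n → Fin n) →
  (∀ i j → e′ i j ≡ e (ρ i) (σ j)) → RowsAvoid w e σ → RowsAvoid w e′ id
rowsAvoid-permute⇐ w e e′ ρ σ e′≗ avoid i spells = avoid (ρ i) (λ j → trans (sym (e′≗ i j)) (spells j))

relabel-avoids⇒ : ∀ {n} (π : Vec (Fin n) n) {ρ τ : Fin n → Fin n} (g : Grid n) →
  IsInjection π → Injective _≡_ _≡_ ρ → Injective _≡_ _≡_ τ → Avoids π (relabel ρ τ g) →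
  RowsAvoid (lookup π) (flip (entry g)) ρ × RowsAvoid (lookup π) (entry g) τ
relabel-avoids⇒ π {ρ} {τ} g π-inj ρ-inj τ-inj avoids with avoids⇒ π (relabel ρ τ g) π-inj avoids
... | rows , columns =
  rowsAvoid-permute⇒ (lookup π) (flip (entry g)) (flip (entry (relabel ρ τ g))) τ ρ
    (injective⇒surjective τ-inj) (λ j i → entry-relabel ρ τ g i j) columns ,
  rowsAvoid-permute⇒ (lookup π) (entry g) (entry (relabel ρ τ g)) ρ τ
    (injective⇒surjective ρ-inj) (entry-relabel ρ τ g) rows

relabel-avoids⇐ : ∀ {n} (π : Vec (Fin n) n) {ρ τ : Fin n → Fin n} (g : Grid n) → IsInjection π →
  RowsAvoid (lookup π) (flip (entry g)) ρ × RowsAvoid (lookup π) (entry g) τ → Avoids π (relabel ρ τ g)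
relabel-avoids⇐ π {ρ} {τ} g π-inj (columns , rows) = avoids⇐ π (relabel ρ τ g) π-inj
  (rowsAvoid-permute⇐ (lookup π) (entry g) (entry (relabel ρ τ g)) ρ τ (entry-relabel ρ τ g) rows ,
   rowsAvoid-permute⇐ (lookup π) (flip (entry g)) (flip (entry (relabel ρ τ g))) τ ρ (λ j i → entry-relabel ρ τ g i j) columns)

relabel-latin⇔ : ∀ {n} {ρ τ : Fin n → Fin n} (g : Grid n) → Injective _≡_ _≡_ ρ → Injective _≡_ _≡_ τ →
                 (IsLatin g → IsLatin (relabel ρ τ g)) × (IsLatin (relabel ρ τ g) → IsLatin g)
relabel-latin⇔ {n} {ρ} {τ} g ρ-inj τ-inj =
  (λ latin → isLatin⇐ (relabel ρ τ g) (relabel-latin g ρ-inj τ-inj (isLatin⇒ g latin))) ,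
  (λ latin → subst IsLatin (relabel-inverse ρ ρ⁻¹ τ τ⁻¹ ρ∘ρ⁻¹ τ∘τ⁻¹ g)
    (isLatin⇐ (relabel ρ⁻¹ τ⁻¹ h) (relabel-latin h ρ⁻¹-injective τ⁻¹-injective (isLatin⇒ h latin))))
  where
  open Inverse ρ ρ-inj renaming (f⁻¹ to ρ⁻¹; f∘f⁻¹ to ρ∘ρ⁻¹; f⁻¹-injective to ρ⁻¹-injective)
  open Inverse τ τ-inj renaming (f⁻¹ to τ⁻¹; f∘f⁻¹ to τ∘τ⁻¹; f⁻¹-injective to τ⁻¹-injective)
  h : Grid n
  h = relabel ρ τ g

-- In a Latin table e, exactly n! − n permutations σ let all rows avoid spelling
-- a given permutation w: each row spells w along exactly one permutation, and
-- (columns being injective) no permutation is spelled along by two rows.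
module RowsAvoidCount {n} (w : Fin n → Fin n) (w-inj : Injective _≡_ _≡_ w)
                      (e : Fin n → Fin n → Fin n) (latin : IsLatinTable e) where

  Spells : Fin n → Vec (Fin n) n → Set
  Spells a σ = ∀ j → e a (lookup σ j) ≡ w j

  spells? : ∀ a σ → Dec (Spells a σ)
  spells? a σ = FP.all? (λ j → e a (lookup σ j) FP.≟ w j)

  spelling-row-unique : ∀ {a a′} σ → Spells a σ → Spells a′ σ → a ≡ a′
  spelling-row-unique {a} {a′} σ s s′ = proj₂ latin (lookup σ a) (trans (s a) (sym (s′ a)))

  avoids+spellers≡1 : ∀ σ → ⟦ rowsAvoid? w e (lookup σ) ⟧ + ∑[ a ← allFin n ] ⟦ spells? a σ ⟧ ≡ 1
  avoids+spellers≡1 σ with FP.any? (λ a → spells? a σ)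
  ... | yes (a , s) = trans (cong₂ _+_ (⟦⟧-no (rowsAvoid? w e (lookup σ)) (λ avoid → avoid a s))
                                        (∑-cong (allFin n) (λ a′ → ⟦⟧-cong (spells? a′ σ) (a′ FP.≟ a)
                                                                      (λ s′ → spelling-row-unique σ s′ s) (λ { refl → s }))))
                            (allFin-enumeration n a)
  ... | no none = trans (cong₂ _+_ (⟦⟧-yes (rowsAvoid? w e (lookup σ)) (λ a s → none (a , s)))
                                   (∑-cong (allFin n) (λ a → ⟦⟧-no (spells? a σ) (λ s → none (a , s)))))
                        (cong suc (∑-zero (allFin n)))

  -- Row a spells w exactly along the permutation (e a)⁻¹ ∘ w.
  spelling-permutations≡1 : ∀ a → ∑[ σ ← injections n n ] ⟦ spells? a σ ⟧ ≡ 1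
  spelling-permutations≡1 a = begin
    ∑[ σ ← injections n n ] ⟦ spells? a σ ⟧
      ≡⟨ ∑-cong (injections n n) (λ σ → ⟦⟧-cong (spells? a σ) (σ ≟ᵥ σₐ) spells⇒≡ ≡⇒spells) ⟩
    multiplicity _≟ᵥ_ σₐ (injections n n)
      ≡⟨ multiplicity-injections n n σₐ ⟩
    ⟦ isInjection? σₐ ⟧
      ≡⟨ ⟦⟧-yes (isInjection? σₐ) σₐ-injection ⟩
    1
      ∎
    where
    open ≡-Reasoning
    open Inverse (e a) (proj₁ latin a) renaming (f⁻¹ to eₐ⁻¹; f∘f⁻¹ to eₐ∘eₐ⁻¹)
    σₐ : Vec (Fin n) n
    σₐ = V.tabulate (eₐ⁻¹ ∘ w)
    σₐ-spells : Spells a σₐ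
    σₐ-spells j = trans (cong (e a) (VP.lookup∘tabulate _ j)) (eₐ∘eₐ⁻¹ (w j))
    σₐ-injection : IsInjection σₐ
    σₐ-injection {i} {j} eq = w-inj (trans (sym (σₐ-spells i)) (trans (cong (e a) eq) (σₐ-spells j)))
    spells⇒≡ : ∀ {σ} → Spells a σ → σ ≡ σₐ
    spells⇒≡ {σ} s = vec-ext σ σₐ (λ j → proj₁ latin a (trans (s j) (sym (σₐ-spells j))))
    ≡⇒spells : ∀ {σ} → σ ≡ σₐ → Spells a σ
    ≡⇒spells refl = σₐ-spells

  avoiding : ℕ
  avoiding = ∑[ σ ← injections n n ] ⟦ rowsAvoid? w e (lookup σ) ⟧

  -- Summing avoids+spellers≡1 over all n! permutations: the avoiding ones
  -- together with one spelled permutation per row.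
  avoiding+n≡n! : avoiding + n ≡ n !
  avoiding+n≡n! = begin
    avoiding + n
      ≡⟨ cong (avoiding +_) (trans (sym (LP.length-tabulate id)) (length≡∑1 (allFin n))) ⟩
    avoiding + ∑[ a ← allFin n ] 1
      ≡⟨ cong (avoiding +_) (∑-cong (allFin n) spelling-permutations≡1) ⟨
    avoiding + ∑[ a ← allFin n ] ∑[ σ ← injections n n ] ⟦ spells? a σ ⟧
      ≡⟨ cong (avoiding +_) (∑-swap _ (allFin n) (injections n n)) ⟩
    avoiding + ∑[ σ ← injections n n ] ∑[ a ← allFin n ] ⟦ spells? a σ ⟧
      ≡⟨ ∑-+ _ _ (injections n n) ⟨
    ∑[ σ ← injections n n ] (⟦ rowsAvoid? w e (lookup σ) ⟧ + ∑[ a ← allFin n ] ⟦ spells? a σ ⟧)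
      ≡⟨ ∑-cong (injections n n) avoids+spellers≡1 ⟩
    ∑[ σ ← injections n n ] 1
      ≡⟨ trans (sym (length≡∑1 (injections n n))) (length-injections n) ⟩
    n !
      ∎
    where open ≡-Reasoning

  count : avoiding ≡ n ! ∸ n
  count = trans (sym (m+n∸n≡m avoiding n)) (cong (_∸ n) avoiding+n≡n!)

module DoubleCounting {n} (π : Vec (Fin n) n) (π-inj : IsInjection π) where

  permutations : List (Vec (Fin n) n)
  permutations = injections n n

  latinAvoiding? : (g : Grid n) → Dec (IsLatin g × Avoids π g)
  latinAvoiding? g = isLatin? g ×-dec avoids? π g

  triple : Grid n → Vec (Fin n) n → Vec (Fin n) n → ℕ
  triple g ρ τ = ⟦ isLatin? g ×-dec avoids? π (relabel (lookup ρ) (lookup τ) g) ⟧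

  -- For fixed permutations ρ, τ, relabelling is a bijection of grids that
  -- preserves Latinness, so the triples are counted by L-avoid n π.
  ∑-grids : ∀ {ρ τ} → IsInjection ρ → IsInjection τ → ∑[ g ← allGrids n ] triple g ρ τ ≡ L-avoid n π
  ∑-grids {ρ} {τ} ρ-inj τ-inj = begin
    ∑[ g ← allGrids n ] triple g ρ τ
      ≡⟨ ∑-cong (allGrids n) (λ g → ⟦⟧-cong (isLatin? g ×-dec avoids? π (relabel′ g)) (latinAvoiding? (relabel′ g))
           (λ (l , a) → proj₁ (relabel-latin⇔ g ρ-inj τ-inj) l , a) (λ (l , a) → proj₂ (relabel-latin⇔ g ρ-inj τ-inj) l , a)) ⟩
    ∑[ g ← allGrids n ] ⟦ latinAvoiding? (relabel′ g) ⟧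
      ≡⟨ ∑-reindex (VP.≡-dec _≟ᵥ_) {allGrids n} relabel′ (relabel ρ⁻¹ τ⁻¹)
           (relabel-inverse (lookup ρ) ρ⁻¹ (lookup τ) τ⁻¹ ρ∘ρ⁻¹ τ∘τ⁻¹) (relabel-inverse ρ⁻¹ (lookup ρ) τ⁻¹ (lookup τ) ρ⁻¹∘ρ τ⁻¹∘τ)
           grids-enumeration (λ g → ⟦ latinAvoiding? g ⟧) ⟩
    ∑[ g ← allGrids n ] ⟦ latinAvoiding? g ⟧
      ≡⟨ length-filter≡∑ latinAvoiding? (allGrids n) ⟨
    L-avoid n π
      ∎
    where
    open ≡-Reasoning
    open Inverse (lookup ρ) ρ-inj renaming (f⁻¹ to ρ⁻¹; f∘f⁻¹ to ρ∘ρ⁻¹; f⁻¹∘f to ρ⁻¹∘ρ)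
    open Inverse (lookup τ) τ-inj renaming (f⁻¹ to τ⁻¹; f∘f⁻¹ to τ∘τ⁻¹; f⁻¹∘f to τ⁻¹∘τ)
    relabel′ : Grid n → Grid n
    relabel′ = relabel (lookup ρ) (lookup τ)
    grids-enumeration : IsEnumeration (VP.≡-dec _≟ᵥ_) (allGrids n)
    grids-enumeration = allVec-enumeration _≟ᵥ_ (allVec-enumeration FP._≟_ (allFin-enumeration n) n) n

  triple-latin : ∀ {ρ τ} → IsInjection ρ → IsInjection τ → ∀ g → IsLatin g →
                 triple g ρ τ ≡ ⟦ rowsAvoid? (lookup π) (flip (entry g)) (lookup ρ) ⟧ * ⟦ rowsAvoid? (lookup π) (entry g) (lookup τ) ⟧
  triple-latin {ρ} {τ} ρ-inj τ-inj g latin = trans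
    (⟦⟧-cong (isLatin? g ×-dec avoids? π (relabel (lookup ρ) (lookup τ) g)) (columns? ×-dec rows?)
             (λ (_ , a) → relabel-avoids⇒ π g π-inj ρ-inj τ-inj a) (λ a → latin , relabel-avoids⇐ π g π-inj a))
    (⟦⟧-× columns? rows?)
    where
    columns? = rowsAvoid? (lookup π) (flip (entry g)) (lookup ρ)
    rows?    = rowsAvoid? (lookup π) (entry g) (lookup τ)

  ∑-permutations : ∀ g → ∑[ ρ ← permutations ] ∑[ τ ← permutations ] triple g ρ τ ≡ ⟦ isLatin? g ⟧ * (n ! ∸ n) ^ 2
  ∑-permutations g = by-latinness (isLatin? g)
    where
    by-latinness : (d : Dec (IsLatin g)) → ∑[ ρ ← permutations ] ∑[ τ ← permutations ] triple g ρ τ ≡ ⟦ d ⟧ * (n ! ∸ n) ^ 2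
    by-latinness (no ¬latin) = begin
      ∑[ ρ ← permutations ] ∑[ τ ← permutations ] triple g ρ τ
        ≡⟨ ∑-cong permutations (λ ρ → ∑-cong permutations (λ τ →
             ⟦⟧-no (isLatin? g ×-dec avoids? π (relabel (lookup ρ) (lookup τ) g)) (¬latin ∘ proj₁))) ⟩
      ∑[ ρ ← permutations ] ∑[ τ ← permutations ] 0
        ≡⟨ ∑-cong permutations (λ ρ → ∑-zero permutations) ⟩
      ∑[ ρ ← permutations ] 0
        ≡⟨ ∑-zero permutations ⟩
      0
        ∎
      where open ≡-Reasoning
    by-latinness (yes latin) = begin
      ∑[ ρ ← permutations ] ∑[ τ ← permutations ] triple g ρ τ
        ≡⟨ ∑-cong∈ permutations (λ ρ ρ∈ → ∑-cong∈ permutations (λ τ τ∈ →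
             triple-latin {ρ} {τ} (∈-injections⇒injection ρ∈) (∈-injections⇒injection τ∈) g latin)) ⟩
      ∑[ ρ ← permutations ] ∑[ τ ← permutations ] (columns-avoid ρ * rows-avoid τ)
        ≡⟨ ∑-cong permutations (λ ρ → ∑-*ˡ (columns-avoid ρ) rows-avoid permutations) ⟩
      ∑[ ρ ← permutations ] (columns-avoid ρ * ∑ permutations rows-avoid)
        ≡⟨ ∑-cong permutations (λ ρ → trans (cong (columns-avoid ρ *_) Rows.count) (*-comm (columns-avoid ρ) _)) ⟩
      ∑[ ρ ← permutations ] ((n ! ∸ n) * columns-avoid ρ)
        ≡⟨ ∑-*ˡ (n ! ∸ n) columns-avoid permutations ⟩
      (n ! ∸ n) * ∑ permutations columns-avoid
        ≡⟨ cong ((n ! ∸ n) *_) (trans Columns.count (sym (*-identityʳ (n ! ∸ n)))) ⟩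
      (n ! ∸ n) ^ 2
        ≡⟨ +-identityʳ ((n ! ∸ n) ^ 2) ⟨
      1 * (n ! ∸ n) ^ 2
        ∎
      where
      open ≡-Reasoning
      table : IsLatinTable (entry g)
      table = isLatin⇒ g latin
      module Rows    = RowsAvoidCount (lookup π) π-inj (entry g) table
      module Columns = RowsAvoidCount (lookup π) π-inj (flip (entry g)) (proj₂ table , proj₁ table)
      rows-avoid columns-avoid : Vec (Fin n) n → ℕ
      rows-avoid τ = ⟦ rowsAvoid? (lookup π) (entry g) (lookup τ) ⟧
      columns-avoid ρ = ⟦ rowsAvoid? (lookup π) (flip (entry g)) (lookup ρ) ⟧

  triples : ℕ
  triples = ∑[ g ← allGrids n ] ∑[ ρ ← permutations ] ∑[ τ ← permutations ] triple g ρ τ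

  triples-by-relabelling : triples ≡ (n !) ^ 2 * L-avoid n π
  triples-by-relabelling = begin
    triples
      ≡⟨ ∑-swap _ (allGrids n) permutations ⟩
    ∑[ ρ ← permutations ] ∑[ g ← allGrids n ] ∑[ τ ← permutations ] triple g ρ τ
      ≡⟨ ∑-cong permutations (λ ρ → ∑-swap _ (allGrids n) permutations) ⟩
    ∑[ ρ ← permutations ] ∑[ τ ← permutations ] ∑[ g ← allGrids n ] triple g ρ τ
      ≡⟨ ∑-cong∈ permutations (λ ρ ρ∈ → ∑-cong∈ permutations (λ τ τ∈ →
           ∑-grids {ρ} {τ} (∈-injections⇒injection ρ∈) (∈-injections⇒injection τ∈))) ⟩
    ∑[ ρ ← permutations ] ∑[ τ ← permutations ] L-avoid n π
      ≡⟨ ∑-cong permutations (λ ρ → ∑-const (L-avoid n π) permutations) ⟩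
    ∑[ ρ ← permutations ] (L-avoid n π * length permutations)
      ≡⟨ ∑-const _ permutations ⟩
    L-avoid n π * length permutations * length permutations
      ≡⟨ cong₂ (λ a b → L-avoid n π * a * b) (length-injections n) (length-injections n) ⟩
    L-avoid n π * n ! * n !
      ≡⟨ a*b*b≡b²*a (L-avoid n π) (n !) ⟩
    (n !) ^ 2 * L-avoid n π
      ∎
    where
    open ≡-Reasoning
    a*b*b≡b²*a : ∀ a b → a * b * b ≡ b ^ 2 * a
    a*b*b≡b²*a a b = trans (*-assoc a b b) (trans (*-comm a (b * b)) (cong (λ c → b * c * a) (sym (*-identityʳ b))))

  triples-by-grid : triples ≡ (n ! ∸ n) ^ 2 * L n
  triples-by-grid = begin
    triples
      ≡⟨ ∑-cong (allGrids n) ∑-permutations ⟩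
    ∑[ g ← allGrids n ] (⟦ isLatin? g ⟧ * (n ! ∸ n) ^ 2)
      ≡⟨ ∑-cong (allGrids n) (λ g → *-comm ⟦ isLatin? g ⟧ _) ⟩
    ∑[ g ← allGrids n ] ((n ! ∸ n) ^ 2 * ⟦ isLatin? g ⟧)
      ≡⟨ ∑-*ˡ ((n ! ∸ n) ^ 2) (λ g → ⟦ isLatin? g ⟧) (allGrids n) ⟩
    (n ! ∸ n) ^ 2 * ∑[ g ← allGrids n ] ⟦ isLatin? g ⟧
      ≡⟨ cong ((n ! ∸ n) ^ 2 *_) (length-filter≡∑ isLatin? (allGrids n)) ⟨
    (n ! ∸ n) ^ 2 * L n
      ∎
    where open ≡-Reasoning

theorem8 : (n : ℕ) → 1 ≤ n → (π : Vec (Fin n) n) → IsPerm π →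
           (n !) ^ 2 * L-avoid n π ≡ ((n !) ∸ n) ^ 2 * L n
theorem8 n _ π π-perm = trans (sym triples-by-relabelling) triples-by-grid
  where open DoubleCounting π (isPerm⇒injection {π = π} π-perm)
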